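{- The language $L_5\subseteq\{a,b\}^*$ is not in $Pol(\mathcal{C}om)(\{a,b\})$.
   Context: $L_5$ is the language recognized by the deterministic automaton with states $1,2,3,4,5$, initial state $1$, accepting set $\{5\}$, and transitions $1\xrightarrow{a}2$, $1\xrightarrow{b}2$, $2\xrightarrow{a}5$, $2\xrightarrow{b}3$, $3\xrightarrow{a}4$, $3\xrightarrow{b}5$, $4\xrightarrow{a}3$, $4\xrightarrow{b}1$, $5\xrightarrow{a}5$, $5\xrightarrow{b}5$. $\mathcal{C}om(\Sigma)$ is the set of regular languages over $\Sigma$ whose syntactic monoid $\Sigma^*/\equiv_L$ (with $x\equiv_L y$ iff for all $u,v$, $uxv\in L\Leftrightarrow uyv\in L$) is commutative; $Pol(\mathcal{C}om)(\Sigma)$ is the set of finite unions of languages $L_0a_1L_1\cdots a_kL_k$ with $k\geq0$, $a_i\in\Sigma$, $L_i\in\mathcal{C}om(\Sigma)$. -}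

module Defs where

open import Data.Nat using (ℕ)
open import Data.Fin using (Fin)
open import Data.Bool using (Bool; true)
open import Data.List using (List; []; _∷_; _++_; foldl)
open import Data.List.Relation.Unary.Any using (Any)
open import Data.Product using (Σ; ∃; ∃-syntax; _×_; _,_)
open import Level using (Level; suc; zero)
open import Relation.Binary.PropositionalEquality using (_≡_)
open import Function.Bundles using (_⇔_)

data Letter : Set where
  a b : Letter

Word : Set
Word = List Letter

Lang : Set₁
Lang = Word → Set

record DFA (n : ℕ) : Set where
  field
    δ      : Fin n → Letter → Fin n
    init   : Fin n
    accept : Fin n → Bool

  run : Fin n → Word → Fin n
  run q []       = q
  run q (c ∷ w)  = run (δ q c) w

  Accepts : Word → Set
  Accepts w = accept (run init w) ≡ true

Regular : Lang → Set
Regular L = ∃[ n ] Σ (DFA n) λ A → ∀ w → L w ⇔ DFA.Accepts A w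

SyntEq : Lang → Word → Word → Set
SyntEq L x y = ∀ u v → L (u ++ x ++ v) ⇔ L (u ++ y ++ v)

-- The syntactic monoid Σ*/≡_L is commutative: [x][y] = [y][x] for all x, y,
-- i.e. xy ≡_L yx.
Com : Lang → Set
Com L = Regular L × (∀ x y → SyntEq L (x ++ y) (y ++ x))

-- Monomials L₀ a₁ L₁ ⋯ aₖ Lₖ : a first language plus a list of (aᵢ , Lᵢ)
record Monomial : Set₁ where
  constructor mono
  field
    L₀   : Lang
    rest : List (Letter × Lang)

InProduct : Lang → List (Letter × Lang) → Word → Set
InProduct L₀ []              w = L₀ w
InProduct L₀ ((c , L₁) ∷ r) w =
  ∃[ u ] ∃[ v ] (w ≡ u ++ c ∷ v) × L₀ u × InProduct L₁ r v

data AllLangsCom : Lang → List (Letter × Lang) → Set₁ where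
  []  : ∀ {L₀} → Com L₀ → AllLangsCom L₀ []
  _∷_ : ∀ {L₀ c L₁ r} → Com L₀ → AllLangsCom L₁ r → AllLangsCom L₀ ((c , L₁) ∷ r)

InPolCom : Lang → Set₁
InPolCom L = ∃[ ms ] (Data.List.Relation.Unary.All.All (λ m → AllLangsCom (Monomial.L₀ m) (Monomial.rest m)) ms)
               × (∀ w → L w ⇔ Any (λ m → InProduct (Monomial.L₀ m) (Monomial.rest m) w) ms)
  where import Data.List.Relation.Unary.All

data Q : Set where
  q1 q2 q3 q4 q5 : Q

δ₅ : Q → Letter → Q
δ₅ q1 a = q2
δ₅ q1 b = q2
δ₅ q2 a = q5
δ₅ q2 b = q3
δ₅ q3 a = q4
δ₅ q3 b = q5
δ₅ q4 a = q3
δ₅ q4 b = q1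
δ₅ q5 a = q5
δ₅ q5 b = q5

run₅ : Q → Word → Q
run₅ q []      = q
run₅ q (c ∷ w) = run₅ (δ₅ q c) w

L₅ : Lang
L₅ w = run₅ q1 w ≡ q5

-- Choose n larger than the total number of marked letters aᵢ in a union of monomials
-- L₀ a₁ L₁ ⋯ aₖ Lₖ containing (abab)ⁿaa ∈ L₅.  Then in the monomial containing this word
-- some factor Lᵢ contains a whole block abab; as the syntactic monoid of Lᵢ is commutative,
-- that block may be replaced by bbaa without leaving the monomial.  But abab loops at the
-- states 1 and 3 of the automaton, bbaa leads from 1 to 3 and aa from 3 to 3, so the new word
-- is rejected.
module Submission where

open import Defs
open import Data.Nat using (ℕ; zero; suc; _+_; _<_; s≤s)
open import Data.Nat.Properties using (≤-refl; ≤-trans; m≤m+n; m≤n+m; m<n⇒m<1+n)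
open import Data.List using (List; []; _∷_; _++_; length; map)
open import Data.Nat.ListAction using (sum)
open import Data.List.Properties using (++-assoc; ∷-injective)
open import Data.List.Relation.Unary.Any using (Any; here; there)
open import Data.List.Relation.Unary.All using (All; _∷_)
open import Data.List.Relation.Binary.Permutation.Propositional as ↭ using (_↭_)
open import Data.Product using (∃-syntax; _×_; _,_; proj₂)
open import Data.Sum using (_⊎_; inj₁; inj₂)
open import Function using (_∘_; id)
open import Function.Bundles using (Equivalence)
open import Relation.Binary.PropositionalEquality
  using (_≡_; refl; sym; trans; cong; subst; module ≡-Reasoning)
open import Relation.Nullary using (¬_)

open Equivalence using (to; from)

++-∷-split : ∀ {X : Set} (us : List X) c vs xs ys → us ++ c ∷ vs ≡ xs ++ ys →
  (∃[ ms ] xs ≡ us ++ c ∷ ms × vs ≡ ms ++ ys) ⊎ (∃[ ms ] us ≡ xs ++ ms × ys ≡ ms ++ c ∷ vs)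
++-∷-split us       c vs []       ys eq = inj₂ (us , refl , sym eq)
++-∷-split []       c vs (x ∷ xs) ys eq with refl , eq′ ← ∷-injective eq =
  inj₁ (xs , refl , eq′)
++-∷-split (u ∷ us) c vs (x ∷ xs) ys eq with refl , eq′ ← ∷-injective eq
  with ++-∷-split us c vs xs ys eq′
... | inj₁ (ms , xs≡ , vs≡) = inj₁ (ms , cong (u ∷_) xs≡ , vs≡)
... | inj₂ (ms , us≡ , ys≡) = inj₂ (ms , cong (u ∷_) us≡ , ys≡)

Substitutable : Lang → Word → Word → Set
Substitutable L x y = ∀ p s → L (p ++ x ++ s) → L (p ++ y ++ s)

module _ {L : Lang} where

  Substitutable-∷ : ∀ {x y} c → Substitutable L x y → Substitutable L (c ∷ x) (c ∷ y)
  Substitutable-∷ {x} {y} c x⇒y p s =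
    subst L (++-assoc p (c ∷ []) (y ++ s)) ∘ x⇒y (p ++ c ∷ []) s
    ∘ subst L (sym (++-assoc p (c ∷ []) (x ++ s)))

  Com⇒Substitutable-↭ : ∀ {x y} → Com L → x ↭ y → Substitutable L x y
  Com⇒Substitutable-↭ com ↭.refl            p s = id
  Com⇒Substitutable-↭ com (↭.prep c x↭y)    = Substitutable-∷ c (Com⇒Substitutable-↭ com x↭y)
  Com⇒Substitutable-↭ com (↭.swap c d x↭y)  p s =
    Substitutable-∷ d (Substitutable-∷ c (Com⇒Substitutable-↭ com x↭y)) p s
    ∘ to (proj₂ com (c ∷ []) (d ∷ []) p (_ ++ s))
  Com⇒Substitutable-↭ com (↭.trans x↭y y↭z) p s =
    Com⇒Substitutable-↭ com y↭z p s ∘ Com⇒Substitutable-↭ com x↭y p s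

infixr 5 _^_·_

_^_·_ : Word → ℕ → Word → Word
x ^ zero  · t = t
x ^ suc n · t = x ++ x ^ n · t

BlockReplaced : Word → Word → ℕ → Word → Word → Set
BlockReplaced x z n t v = ∃[ i ] ∃[ j ] n ≡ suc (i + j) × v ≡ x ^ i · z ++ x ^ j · t

InMonomial : Monomial → Word → Set
InMonomial m = InProduct (Monomial.L₀ m) (Monomial.rest m)

ComMonomial : Monomial → Set₁
ComMonomial m = AllLangsCom (Monomial.L₀ m) (Monomial.rest m)

markers : List Monomial → ℕ
markers = sum ∘ map (length ∘ Monomial.rest)

module _ {x z : Word} (x↭z : x ↭ z) where

  -- Pigeonhole: with fewer markers than blocks, some block lies inside a single factor.
  -- The first marker c lies in q, inside the first block x, or after it.
  product-replace-block : ∀ {L₀ r} → AllLangsCom L₀ r → ∀ q n t → length r < n →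
    InProduct L₀ r (q ++ x ^ n · t) → ∃[ v ] BlockReplaced x z n t v × InProduct L₀ r (q ++ v)
  product-replace-block ([] com) q (suc n) t _ q·xⁿt∈ =
    z ++ x ^ n · t , (0 , n , refl , refl) , Com⇒Substitutable-↭ com x↭z q (x ^ n · t) q·xⁿt∈
  product-replace-block {r = (c , L₁) ∷ r} (com ∷ coms) q (suc n) t (s≤s r<n) (u , w , eq , u∈ , w∈)
    with ++-∷-split u c w q (x ^ suc n · t) (sym eq)
  ... | inj₁ (m , refl , refl)
    with v , replaced , m·v∈ ← product-replace-block coms m (suc n) t (m<n⇒m<1+n r<n) w∈ =
    v , replaced , (u , m ++ v , ++-assoc u (c ∷ m) v , u∈ , m·v∈)
  ... | inj₂ (m , refl , xⁿt≡)
    with ++-∷-split m c w x (x ^ n · t) (sym xⁿt≡)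
  ... | inj₁ (m₂ , x≡ , refl)
    with v , (i , j , n≡ , v≡) , m₂·v∈ ← product-replace-block coms m₂ n t r<n w∈ =
    x ++ v , (suc i , j , cong suc n≡ , cong (x ++_) v≡) , (q ++ m , m₂ ++ v , split-x , u∈ , m₂·v∈)
    where
    open ≡-Reasoning
    split-x : q ++ x ++ v ≡ (q ++ m) ++ c ∷ m₂ ++ v
    split-x = begin
      q ++ x ++ v                ≡⟨ cong (λ y → q ++ y ++ v) x≡ ⟩
      q ++ (m ++ c ∷ m₂) ++ v    ≡⟨ cong (q ++_) (++-assoc m (c ∷ m₂) v) ⟩
      q ++ m ++ c ∷ m₂ ++ v      ≡⟨ ++-assoc q m (c ∷ m₂ ++ v) ⟨
      (q ++ m) ++ c ∷ m₂ ++ v    ∎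
  ... | inj₂ (m₂ , refl , xⁿt≡′) =
    z ++ x ^ n · t , (0 , n , refl , refl) ,
    (q ++ z ++ m₂ , w , split-z , Com⇒Substitutable-↭ com x↭z q m₂ u∈ , w∈)
    where
    open ≡-Reasoning
    split-z : q ++ z ++ x ^ n · t ≡ (q ++ z ++ m₂) ++ c ∷ w
    split-z = begin
      q ++ z ++ x ^ n · t        ≡⟨ cong (λ y → q ++ z ++ y) xⁿt≡′ ⟩
      q ++ z ++ m₂ ++ c ∷ w      ≡⟨ cong (q ++_) (++-assoc z m₂ (c ∷ w)) ⟨
      q ++ (z ++ m₂) ++ c ∷ w    ≡⟨ ++-assoc q (z ++ m₂) (c ∷ w) ⟨
      (q ++ z ++ m₂) ++ c ∷ w    ∎

  union-replace-block : ∀ {ms} → All ComMonomial ms → ∀ n t → markers ms < n →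
    Any (λ m → InMonomial m (x ^ n · t)) ms → ∃[ v ] BlockReplaced x z n t v × Any (λ m → InMonomial m v) ms
  union-replace-block (com ∷ coms) n t <n (here xⁿt∈)
    with v , replaced , v∈ ← product-replace-block com [] n t (≤-trans (s≤s (m≤m+n _ _)) <n) xⁿt∈ =
    v , replaced , here v∈
  union-replace-block (com ∷ coms) n t <n (there xⁿt∈)
    with v , replaced , v∈ ← union-replace-block coms n t (≤-trans (s≤s (m≤n+m _ _)) <n) xⁿt∈ =
    v , replaced , there v∈

abab bbaa aa : Word
abab = a ∷ b ∷ a ∷ b ∷ []
bbaa = b ∷ b ∷ a ∷ a ∷ []
aa   = a ∷ a ∷ []

abab↭bbaa : abab ↭ bbaa
abab↭bbaa = ↭.trans (↭.swap a b ↭.refl)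
  (↭.prep b (↭.trans (↭.prep a (↭.swap a b ↭.refl)) (↭.swap a b ↭.refl)))

run₅-loop : ∀ {q x} → (∀ w → run₅ q (x ++ w) ≡ run₅ q w) → ∀ i w → run₅ q (x ^ i · w) ≡ run₅ q w
run₅-loop loop zero    w = refl
run₅-loop loop (suc i) w = trans (loop _) (run₅-loop loop i w)

abab^n·aa∈L₅ : ∀ n → L₅ (abab ^ n · aa)
abab^n·aa∈L₅ n = run₅-loop (λ _ → refl) n aa

run₅-abab^i·bbaa·abab^j·aa : ∀ i j → run₅ q1 (abab ^ i · bbaa ++ abab ^ j · aa) ≡ q3
run₅-abab^i·bbaa·abab^j·aa i j = begin
  run₅ q1 (abab ^ i · bbaa ++ abab ^ j · aa)   ≡⟨ run₅-loop (λ _ → refl) i _ ⟩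
  run₅ q3 (abab ^ j · aa)                      ≡⟨ run₅-loop (λ _ → refl) j aa ⟩
  q3                                           ∎
  where open ≡-Reasoning

abab^i·bbaa·abab^j·aa∉L₅ : ∀ i j → ¬ L₅ (abab ^ i · bbaa ++ abab ^ j · aa)
abab^i·bbaa·abab^j·aa∉L₅ i j ∈L₅ with () ← trans (sym (run₅-abab^i·bbaa·abab^j·aa i j)) ∈L₅

propositionA2 : ¬ InPolCom L₅
propositionA2 (ms , coms , L₅⇔)
  with v , (i , j , _ , refl) , v∈ ← union-replace-block abab↭bbaa coms (suc (markers ms)) aa ≤-refl
         (to (L₅⇔ _) (abab^n·aa∈L₅ (suc (markers ms))))
  = abab^i·bbaa·abab^j·aa∉L₅ i j (from (L₅⇔ _) v∈)
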